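{- For $n\ge 2$, the leading coefficient of $L_{n,2,n-1}(x)$ is $\lfloor n/2\rfloor^2\,(n-2)!$, and \[\frac{L_{n,2,n-1}(x)}{(n-2)!}=\left\lfloor\frac n2\right\rfloor^2x+n(n-1)-\left\lfloor\frac n2\right\rfloor^2.\]
   Context: $S_n$ is the set of permutations of $\{1,\dots,n\}$. For an inversion $(a,b)$ of $\pi$ (i.e. $a<b$, $\pi(a)>\pi(b)$), its inversion top is the value $\pi(a)$. A $k$-step inversion is an inversion $(a,b)$ with $b-a=k$. $\operatorname{modinv}_{d,k}(\pi)$ is the number of $k$-step inversions of $\pi$ whose inversion top is divisible by $d$, and $L_{n,d,k}(x)=\sum_{\pi\in S_n}x^{\operatorname{modinv}_{d,k}(\pi)}$. -}

module Defs where

open import Data.Nat using (ℕ; zero; suc; _+_; _*_; _∸_; _<_; _<ᵇ_; _≡ᵇ_)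
open import Data.Nat.Divisibility using (_∣?_)
open import Data.Bool using (Bool; true; false; _∧_; not)
open import Data.List using (List; []; _∷_; map; concatMap; filterᵇ; length; zip; drop; upTo)
open import Data.Product using (_×_; _,_; Σ)
open import Relation.Nullary.Decidable using (does)
open import Relation.Binary.PropositionalEquality using (_≡_; _≢_)

-- Permutations of {1,…,n} in one-line notation: the list [π(1), …, π(n)].

words : ℕ → ℕ → List (List ℕ)
words n zero    = [] ∷ []
words n (suc m) = concatMap (λ v → map (v ∷_) (words n m)) (map suc (upTo n))

noneEq : ℕ → List ℕ → Bool
noneEq x []       = true
noneEq x (y ∷ ys) = not (x ≡ᵇ y) ∧ noneEq x ys

distinct : List ℕ → Bool
distinct []       = true
distinct (x ∷ xs) = noneEq x xs ∧ distinct xs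

S : ℕ → List (List ℕ)
S n = filterᵇ distinct (words n n)

-- modinv_{d,k}(π): the k-step pairs (a, a+k) are exactly the pairs (π(a), π(a+k))
-- given by zipping π with π shifted by k; count those that are inversions
-- (π(a) > π(a+k)) whose top π(a) is divisible by d.
modinv : ℕ → ℕ → List ℕ → ℕ
modinv d k π =
  length (filterᵇ (λ p → (Data.Product.proj₂ p <ᵇ Data.Product.proj₁ p) ∧ does (d ∣? Data.Product.proj₁ p))
                  (zip π (drop k π)))

-- L_{n,d,k}(x) = Σ_{π ∈ S_n} x^{modinv_{d,k}(π)}, represented by its coefficient
-- sequence: the coefficient of x^j is #{π ∈ S_n | modinv_{d,k}(π) = j}.
Lcoeff : ℕ → ℕ → ℕ → ℕ → ℕ
Lcoeff n d k j = length (filterᵇ (λ π → modinv d k π ≡ᵇ j) (S n))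

LeadingCoeff : (ℕ → ℕ) → ℕ → Set
LeadingCoeff p c = Σ ℕ λ deg → (p deg ≡ c) × (c ≢ 0) × (∀ j → deg < j → p j ≡ 0)

linPoly : ℕ → ℕ → ℕ → ℕ
linPoly a b zero          = b
linPoly a b (suc zero)    = a
linPoly a b (suc (suc j)) = 0

-- Only the pair (π(1), π(n)) is n − 1 steps apart, so modinv_{2,n−1}(π) is the indicator that this
-- pair is an inversion with even top. Every ordered pair (a, b) of distinct values occurs as
-- (π(1), π(n)) for exactly (n − 2)! permutations, so each coefficient of L_{n,2,n−1} is (n − 2)!
-- times a count of such pairs, and the pairs b < a with a even number Σ_{a even} (a − 1) = ⌊n/2⌋².
module Submission where

open import Defs
open import Data.Nat using (ℕ; zero; suc; _+_; _*_; _∸_; _≤_; _<_; _/_; _!; _<ᵇ_; _≡ᵇ_; z≤n; s≤s; z<s; _<?_; ≢-nonZero⁻¹)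
open import Data.Nat.Properties
open import Data.Nat.Divisibility using (_∣?_)
open import Data.Nat.DivMod using (m/n≡1+[m∸n]/n)
open import Data.Bool using (Bool; true; false; _∧_; not; if_then_else_; T)
open import Data.Bool.Properties using (∧-zeroʳ; ∧-identityʳ)
open import Data.List using (List; []; _∷_; _++_; map; concatMap; filterᵇ; length; drop; upTo; applyUpTo)
open import Data.List.Properties using (length-map; length-upTo; map-upTo)
open import Data.List.Membership.Propositional using (_∈_)
open import Data.List.Relation.Unary.Any using (here; there)
open import Data.Product using (_×_; _,_)
open import Data.Unit using (tt)
open import Relation.Nullary using (yes; no; does)
open import Relation.Binary.PropositionalEquality
open import Data.Nat.Tactic.RingSolver using (solve-∀)

private variable
  X Y : Set

𝟙 : Bool → ℕ
𝟙 true  = 1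
𝟙 false = 0

sumBy : (X → ℕ) → List X → ℕ
sumBy f []       = 0
sumBy f (x ∷ xs) = f x + sumBy f xs

sumBy-cong-∈ : ∀ {f g : X → ℕ} xs → (∀ {x} → x ∈ xs → f x ≡ g x) → sumBy f xs ≡ sumBy g xs
sumBy-cong-∈ []       f≗g = refl
sumBy-cong-∈ (x ∷ xs) f≗g = cong₂ _+_ (f≗g (here refl)) (sumBy-cong-∈ xs (λ x∈xs → f≗g (there x∈xs)))

sumBy-cong : ∀ {f g : X → ℕ} xs → (∀ x → f x ≡ g x) → sumBy f xs ≡ sumBy g xs
sumBy-cong xs f≗g = sumBy-cong-∈ xs (λ {x} _ → f≗g x)

sumBy-+ : ∀ (f g : X → ℕ) xs → sumBy (λ x → f x + g x) xs ≡ sumBy f xs + sumBy g xs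
sumBy-+ f g []       = refl
sumBy-+ f g (x ∷ xs) = begin
  f x + g x + sumBy (λ x → f x + g x) xs ≡⟨ cong (f x + g x +_) (sumBy-+ f g xs) ⟩
  f x + g x + (sumBy f xs + sumBy g xs)  ≡⟨ +-interchange (f x) (g x) _ _ ⟩
  f x + sumBy f xs + (g x + sumBy g xs)  ∎
  where
  open ≡-Reasoning
  +-interchange : ∀ a b c d → a + b + (c + d) ≡ a + c + (b + d)
  +-interchange = solve-∀

sumBy-*ˡ : ∀ c (f : X → ℕ) xs → sumBy (λ x → c * f x) xs ≡ c * sumBy f xs
sumBy-*ˡ c f []       = sym (*-zeroʳ c)
sumBy-*ˡ c f (x ∷ xs) = trans (cong (c * f x +_) (sumBy-*ˡ c f xs)) (sym (*-distribˡ-+ c (f x) _))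

sumBy-const : ∀ c (xs : List X) → sumBy (λ _ → c) xs ≡ length xs * c
sumBy-const c []       = refl
sumBy-const c (x ∷ xs) = cong (c +_) (sumBy-const c xs)

sumBy-zero : ∀ {f : X → ℕ} xs → (∀ x → f x ≡ 0) → sumBy f xs ≡ 0
sumBy-zero xs f≗0 = trans (sumBy-cong xs f≗0) (trans (sumBy-const 0 xs) (*-zeroʳ (length xs)))

sumBy-++ : ∀ (f : X → ℕ) xs ys → sumBy f (xs ++ ys) ≡ sumBy f xs + sumBy f ys
sumBy-++ f []       ys = refl
sumBy-++ f (x ∷ xs) ys = trans (cong (f x +_) (sumBy-++ f xs ys)) (sym (+-assoc (f x) _ _))

sumBy-map : ∀ (f : Y → ℕ) (g : X → Y) xs → sumBy f (map g xs) ≡ sumBy (λ x → f (g x)) xs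
sumBy-map f g []       = refl
sumBy-map f g (x ∷ xs) = cong (f (g x) +_) (sumBy-map f g xs)

sumBy-concatMap : ∀ (f : Y → ℕ) (g : X → List Y) xs →
                  sumBy f (concatMap g xs) ≡ sumBy (λ x → sumBy f (g x)) xs
sumBy-concatMap f g []       = refl
sumBy-concatMap f g (x ∷ xs) =
  trans (sumBy-++ f (g x) (concatMap g xs)) (cong (sumBy f (g x) +_) (sumBy-concatMap f g xs))

length-filterᵇ-filterᵇ : ∀ (p q : X → Bool) xs →
                         length (filterᵇ q (filterᵇ p xs)) ≡ sumBy (λ x → 𝟙 (p x ∧ q x)) xs
length-filterᵇ-filterᵇ p q []       = refl
length-filterᵇ-filterᵇ p q (x ∷ xs) with p x
... | false = length-filterᵇ-filterᵇ p q xs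
... | true with q x
...   | true  = cong suc (length-filterᵇ-filterᵇ p q xs)
...   | false = length-filterᵇ-filterᵇ p q xs

≡ᵇ-sym : ∀ x y → (x ≡ᵇ y) ≡ (y ≡ᵇ x)
≡ᵇ-sym zero    zero    = refl
≡ᵇ-sym zero    (suc y) = refl
≡ᵇ-sym (suc x) zero    = refl
≡ᵇ-sym (suc x) (suc y) = ≡ᵇ-sym x y

≡ᵇ-refl : ∀ x → (x ≡ᵇ x) ≡ true
≡ᵇ-refl zero    = refl
≡ᵇ-refl (suc x) = ≡ᵇ-refl x

≡ᵇ≡true⇒≡ : ∀ x y → (x ≡ᵇ y) ≡ true → x ≡ y
≡ᵇ≡true⇒≡ x y eq = ≡ᵇ⇒≡ x y (subst T (sym eq) tt)

<⇒≡ᵇ≡false : ∀ {x y} → x < y → (x ≡ᵇ y) ≡ false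
<⇒≡ᵇ≡false {zero}  {suc y} _         = refl
<⇒≡ᵇ≡false {suc x} {suc y} (s≤s x<y) = <⇒≡ᵇ≡false x<y

≤⇒<ᵇ≡false : ∀ {x y} → x ≤ y → (y <ᵇ x) ≡ false
≤⇒<ᵇ≡false {zero}  _         = refl
≤⇒<ᵇ≡false {suc x} (s≤s x≤y) = ≤⇒<ᵇ≡false x≤y

<⇒<ᵇ≡true : ∀ {x y} → x < y → (x <ᵇ y) ≡ true
<⇒<ᵇ≡true {zero}  {suc y} _         = refl
<⇒<ᵇ≡true {suc x} {suc y} (s≤s x<y) = <⇒<ᵇ≡true x<y

notIn : List ℕ → ℕ → Bool
notIn E x = noneEq x E

module _ (f : ℕ → ℕ) (v : ℕ) where

  sumBy-≡ᵇ-absent : ∀ xs → noneEq v xs ≡ true → sumBy (λ x → if x ≡ᵇ v then f x else 0) xs ≡ 0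
  sumBy-≡ᵇ-absent []       _ = refl
  sumBy-≡ᵇ-absent (x ∷ xs) v∉ with v ≡ᵇ x in v≡ᵇx
  sumBy-≡ᵇ-absent (x ∷ xs) () | true
  ... | false rewrite ≡ᵇ-sym x v | v≡ᵇx = sumBy-≡ᵇ-absent xs v∉

  sumBy-≡ᵇ-single : ∀ xs → distinct xs ≡ true → v ∈ xs → sumBy (λ x → if x ≡ᵇ v then f x else 0) xs ≡ f v
  sumBy-≡ᵇ-single (x ∷ xs) dist v∈ with noneEq x xs in x∉
  sumBy-≡ᵇ-single (x ∷ xs) () v∈ | false
  sumBy-≡ᵇ-single (x ∷ xs) dist v∈ | true with x ≡ᵇ v in x≡ᵇv | v∈
  ... | true  | _ rewrite ≡ᵇ≡true⇒≡ x v x≡ᵇv =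
    trans (cong (f v +_) (sumBy-≡ᵇ-absent xs x∉)) (+-identityʳ (f v))
  ... | false | here refl with () ← trans (sym (≡ᵇ-refl x)) x≡ᵇv
  ... | false | there v∈xs = sumBy-≡ᵇ-single xs dist v∈xs

  sumBy-extract : ∀ xs → distinct xs ≡ true → v ∈ xs →
                  sumBy f xs ≡ sumBy (λ x → if x ≡ᵇ v then 0 else f x) xs + f v
  sumBy-extract xs dist v∈ = begin
    sumBy f xs
      ≡⟨ sumBy-cong xs split ⟩
    sumBy (λ x → (if x ≡ᵇ v then 0 else f x) + (if x ≡ᵇ v then f x else 0)) xs
      ≡⟨ sumBy-+ _ _ xs ⟩
    sumBy (λ x → if x ≡ᵇ v then 0 else f x) xs + sumBy (λ x → if x ≡ᵇ v then f x else 0) xs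
      ≡⟨ cong (sumBy (λ x → if x ≡ᵇ v then 0 else f x) xs +_) (sumBy-≡ᵇ-single xs dist v∈) ⟩
    sumBy (λ x → if x ≡ᵇ v then 0 else f x) xs + f v ∎
    where
    open ≡-Reasoning
    split : ∀ x → f x ≡ (if x ≡ᵇ v then 0 else f x) + (if x ≡ᵇ v then f x else 0)
    split x with x ≡ᵇ v
    ... | true  = refl
    ... | false = sym (+-identityʳ (f x))

wordsOver : List ℕ → ℕ → List (List ℕ)
wordsOver A zero    = [] ∷ []
wordsOver A (suc m) = concatMap (λ v → map (v ∷_) (wordsOver A m)) A

words≡wordsOver : ∀ n m → words n m ≡ wordsOver (map suc (upTo n)) m
words≡wordsOver n zero    = refl
words≡wordsOver n (suc m) =
  cong (λ ws → concatMap (λ v → map (v ∷_) ws) (map suc (upTo n))) (words≡wordsOver n m)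

sumBy-wordsOver-cong : ∀ {f g : List ℕ → ℕ} A m → (∀ w → length w ≡ m → f w ≡ g w) →
                       sumBy f (wordsOver A m) ≡ sumBy g (wordsOver A m)
sumBy-wordsOver-cong A zero    f≗g = cong (_+ 0) (f≗g [] refl)
sumBy-wordsOver-cong {f} {g} A (suc m) f≗g = begin
  sumBy f (wordsOver A (suc m))                       ≡⟨ sumBy-concatMap f _ A ⟩
  sumBy (λ v → sumBy f (map (v ∷_) (wordsOver A m))) A ≡⟨ sumBy-cong A first ⟩
  sumBy (λ v → sumBy g (map (v ∷_) (wordsOver A m))) A ≡⟨ sumBy-concatMap g _ A ⟨
  sumBy g (wordsOver A (suc m))                       ∎
  where
  open ≡-Reasoning
  first : ∀ v → sumBy f (map (v ∷_) (wordsOver A m)) ≡ sumBy g (map (v ∷_) (wordsOver A m))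
  first v = begin
    sumBy f (map (v ∷_) (wordsOver A m))   ≡⟨ sumBy-map f (v ∷_) (wordsOver A m) ⟩
    sumBy (λ w → f (v ∷ w)) (wordsOver A m) ≡⟨ sumBy-wordsOver-cong A m (λ w ∣w∣ → f≗g (v ∷ w) (cong suc ∣w∣)) ⟩
    sumBy (λ w → g (v ∷ w)) (wordsOver A m) ≡⟨ sumBy-map g (v ∷_) (wordsOver A m) ⟨
    sumBy g (map (v ∷_) (wordsOver A m))   ∎

avoids : List ℕ → List ℕ → Bool
avoids E []      = true
avoids E (x ∷ w) = notIn E x ∧ avoids E w

avoids-[] : ∀ w → avoids [] w ≡ true
avoids-[] []      = refl
avoids-[] (x ∷ w) = avoids-[] w

avoids-∷ : ∀ v E w → avoids (v ∷ E) w ≡ noneEq v w ∧ avoids E w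
avoids-∷ v E []      = refl
avoids-∷ v E (x ∷ w) rewrite avoids-∷ v E w | ≡ᵇ-sym x v =
  interchange (not (v ≡ᵇ x)) (noneEq x E) (noneEq v w) (avoids E w)
  where
  interchange : ∀ a b c d → (a ∧ b) ∧ (c ∧ d) ≡ (a ∧ c) ∧ (b ∧ d)
  interchange true  true  c d = refl
  interchange true  false c d = sym (∧-zeroʳ c)
  interchange false b     c d = refl

fresh : List ℕ → List ℕ → Bool
fresh E w = avoids E w ∧ distinct w

fresh-∷ : ∀ E v w → fresh E (v ∷ w) ≡ notIn E v ∧ fresh (v ∷ E) w
fresh-∷ E v w rewrite avoids-∷ v E w = shuffle (notIn E v) (avoids E w) (noneEq v w) (distinct w)
  where
  shuffle : ∀ a b c d → (a ∧ b) ∧ (c ∧ d) ≡ a ∧ ((c ∧ b) ∧ d)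
  shuffle false b     c d = refl
  shuffle true  true  c d = cong (_∧ d) (sym (∧-identityʳ c))
  shuffle true  false c d = cong (_∧ d) (sym (∧-zeroʳ c))

distinct-∷ : ∀ a w → distinct (a ∷ w) ≡ fresh (a ∷ []) w
distinct-∷ a w rewrite avoids-∷ a [] w | avoids-[] w = cong (_∧ distinct w) (sym (∧-identityʳ (noneEq a w)))

lastOr : ℕ → List ℕ → ℕ
lastOr d []      = d
lastOr d (x ∷ w) = lastOr x w

falling : ℕ → ℕ → ℕ
falling x zero    = 1
falling x (suc m) = x * falling (x ∸ 1) m

falling-! : ∀ k → falling k k ≡ k !
falling-! zero    = refl
falling-! (suc k) = cong (suc k *_) (falling-! k)

endsWith : (ℕ → ℕ → Bool) → List ℕ → Bool
endsWith q []      = false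
endsWith q (a ∷ w) = q a (lastOr a w)

module InjectiveWords (A : List ℕ) (A-distinct : distinct A ≡ true) where

  freeWith : List ℕ → (ℕ → Bool) → ℕ
  freeWith E h = sumBy (λ b → 𝟙 (notIn E b ∧ h b)) A

  free : List ℕ → ℕ
  free E = freeWith E (λ _ → true)

  free-[] : free [] ≡ length A
  free-[] = trans (sumBy-const 1 A) (*-identityʳ (length A))

  freeWith-∷ : ∀ {v} E h → v ∈ A → freeWith (v ∷ E) h + 𝟙 (notIn E v ∧ h v) ≡ freeWith E h
  freeWith-∷ {v} E h v∈A = begin
    freeWith (v ∷ E) h + 𝟙 (notIn E v ∧ h v)
      ≡⟨ cong (_+ 𝟙 (notIn E v ∧ h v)) (sumBy-cong A drop-v) ⟩
    sumBy (λ b → if b ≡ᵇ v then 0 else 𝟙 (notIn E b ∧ h b)) A + 𝟙 (notIn E v ∧ h v)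
      ≡⟨ sumBy-extract (λ b → 𝟙 (notIn E b ∧ h b)) v A A-distinct v∈A ⟨
    freeWith E h ∎
    where
    open ≡-Reasoning
    drop-v : ∀ b → 𝟙 (notIn (v ∷ E) b ∧ h b) ≡ (if b ≡ᵇ v then 0 else 𝟙 (notIn E b ∧ h b))
    drop-v b with b ≡ᵇ v
    ... | true  = refl
    ... | false = refl

  free-∷ : ∀ {v} E → v ∈ A → notIn E v ≡ true → free (v ∷ E) ≡ free E ∸ 1
  free-∷ {v} E v∈A v∉E = begin
    free (v ∷ E)                          ≡⟨ m+n∸n≡m (free (v ∷ E)) 1 ⟨
    free (v ∷ E) + 1 ∸ 1                  ≡⟨ cong (λ b → free (v ∷ E) + 𝟙 (b ∧ true) ∸ 1) v∉E ⟨
    free (v ∷ E) + 𝟙 (notIn E v ∧ true) ∸ 1 ≡⟨ cong (_∸ 1) (freeWith-∷ E (λ _ → true) v∈A) ⟩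
    free E ∸ 1                            ∎
    where open ≡-Reasoning

  -- For v ∉ E, freeWith (v ∷ E) h is freeWith E h less [h v], and these corrections sum to freeWith E h.
  sumBy-freeWith-∷ : ∀ E h → sumBy (λ v → 𝟙 (notIn E v) * freeWith (v ∷ E) h) A ≡ (free E ∸ 1) * freeWith E h
  sumBy-freeWith-∷ E h = begin
    Σ                                ≡⟨ m+n∸n≡m Σ (freeWith E h) ⟨
    Σ + freeWith E h ∸ freeWith E h  ≡⟨ cong (_∸ freeWith E h) Σ+freeWith ⟩
    free E * freeWith E h ∸ freeWith E h ≡⟨ cong (free E * freeWith E h ∸_) (*-identityˡ (freeWith E h)) ⟨
    free E * freeWith E h ∸ 1 * freeWith E h ≡⟨ *-distribʳ-∸ (freeWith E h) (free E) 1 ⟨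
    (free E ∸ 1) * freeWith E h      ∎
    where
    open ≡-Reasoning
    Σ : ℕ
    Σ = sumBy (λ v → 𝟙 (notIn E v) * freeWith (v ∷ E) h) A
    pointwise : ∀ {v} → v ∈ A →
      𝟙 (notIn E v) * freeWith (v ∷ E) h + 𝟙 (notIn E v ∧ h v) ≡ freeWith E h * 𝟙 (notIn E v ∧ true)
    pointwise {v} v∈A with notIn E v in v∉E
    ... | false = sym (*-zeroʳ (freeWith E h))
    ... | true  = begin
      freeWith (v ∷ E) h + 0 + 𝟙 (h v) ≡⟨ cong (_+ 𝟙 (h v)) (+-identityʳ _) ⟩
      freeWith (v ∷ E) h + 𝟙 (h v)     ≡⟨ subst (λ b → freeWith (v ∷ E) h + 𝟙 (b ∧ h v) ≡ freeWith E h)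
                                                 v∉E (freeWith-∷ E h v∈A) ⟩
      freeWith E h                     ≡⟨ *-identityʳ _ ⟨
      freeWith E h * 1                 ∎
    Σ+freeWith : Σ + freeWith E h ≡ free E * freeWith E h
    Σ+freeWith = begin
      Σ + freeWith E h
        ≡⟨ sumBy-+ (λ v → 𝟙 (notIn E v) * freeWith (v ∷ E) h) (λ v → 𝟙 (notIn E v ∧ h v)) A ⟨
      sumBy (λ v → 𝟙 (notIn E v) * freeWith (v ∷ E) h + 𝟙 (notIn E v ∧ h v)) A
        ≡⟨ sumBy-cong-∈ A pointwise ⟩
      sumBy (λ v → freeWith E h * 𝟙 (notIn E v ∧ true)) A
        ≡⟨ sumBy-*ˡ (freeWith E h) (λ v → 𝟙 (notIn E v ∧ true)) A ⟩
      freeWith E h * free E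
        ≡⟨ *-comm (freeWith E h) (free E) ⟩
      free E * freeWith E h ∎

  count-fresh-words : ∀ m E h d →
    sumBy (λ w → 𝟙 (fresh E w ∧ h (lastOr d w))) (wordsOver A (suc m)) ≡ falling (free E ∸ 1) m * freeWith E h
  count-fresh-words zero E h d = begin
    sumBy (λ w → 𝟙 (fresh E w ∧ h (lastOr d w))) (wordsOver A 1)
      ≡⟨ sumBy-concatMap _ (λ v → map (v ∷_) (wordsOver A 0)) A ⟩
    sumBy (λ v → 𝟙 (fresh E (v ∷ []) ∧ h v) + 0) A
      ≡⟨ sumBy-cong A single ⟩
    freeWith E h
      ≡⟨ +-identityʳ (freeWith E h) ⟨
    1 * freeWith E h ∎
    where
    open ≡-Reasoning
    single : ∀ v → 𝟙 (fresh E (v ∷ []) ∧ h v) + 0 ≡ 𝟙 (notIn E v ∧ h v)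
    single v = trans (+-identityʳ _) (cong (λ b → 𝟙 (b ∧ h v)) (trans (fresh-∷ E v []) (∧-identityʳ (notIn E v))))
  count-fresh-words (suc m) E h d = begin
    sumBy (λ w → 𝟙 (fresh E w ∧ h (lastOr d w))) (wordsOver A (suc (suc m)))
      ≡⟨ sumBy-concatMap _ (λ v → map (v ∷_) (wordsOver A (suc m))) A ⟩
    sumBy (λ v → sumBy (λ w → 𝟙 (fresh E w ∧ h (lastOr d w))) (map (v ∷_) (wordsOver A (suc m)))) A
      ≡⟨ sumBy-cong-∈ A starting-with ⟩
    sumBy (λ v → c * (𝟙 (notIn E v) * freeWith (v ∷ E) h)) A
      ≡⟨ sumBy-*ˡ c _ A ⟩
    c * sumBy (λ v → 𝟙 (notIn E v) * freeWith (v ∷ E) h) A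
      ≡⟨ cong (c *_) (sumBy-freeWith-∷ E h) ⟩
    c * ((free E ∸ 1) * freeWith E h)
      ≡⟨ *-assoc c (free E ∸ 1) (freeWith E h) ⟨
    c * (free E ∸ 1) * freeWith E h
      ≡⟨ cong (_* freeWith E h) (*-comm c (free E ∸ 1)) ⟩
    falling (free E ∸ 1) (suc m) * freeWith E h ∎
    where
    open ≡-Reasoning
    c : ℕ
    c = falling (free E ∸ 1 ∸ 1) m
    starting-with : ∀ {v} → v ∈ A →
      sumBy (λ w → 𝟙 (fresh E w ∧ h (lastOr d w))) (map (v ∷_) (wordsOver A (suc m)))
        ≡ c * (𝟙 (notIn E v) * freeWith (v ∷ E) h)
    starting-with {v} v∈A = begin
      sumBy (λ w → 𝟙 (fresh E w ∧ h (lastOr d w))) (map (v ∷_) (wordsOver A (suc m)))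
        ≡⟨ sumBy-map _ (v ∷_) (wordsOver A (suc m)) ⟩
      sumBy (λ w → 𝟙 (fresh E (v ∷ w) ∧ h (lastOr v w))) (wordsOver A (suc m))
        ≡⟨ sumBy-cong (wordsOver A (suc m)) (λ w → cong (λ b → 𝟙 (b ∧ h (lastOr v w))) (fresh-∷ E v w)) ⟩
      sumBy (λ w → 𝟙 ((notIn E v ∧ fresh (v ∷ E) w) ∧ h (lastOr v w))) (wordsOver A (suc m))
        ≡⟨ by-first-letter (notIn E v) refl ⟩
      c * (𝟙 (notIn E v) * freeWith (v ∷ E) h) ∎
      where
      by-first-letter : ∀ b → notIn E v ≡ b →
        sumBy (λ w → 𝟙 ((b ∧ fresh (v ∷ E) w) ∧ h (lastOr v w))) (wordsOver A (suc m))
          ≡ c * (𝟙 b * freeWith (v ∷ E) h)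
      by-first-letter false _   = trans (sumBy-zero (wordsOver A (suc m)) (λ _ → refl)) (sym (*-zeroʳ c))
      by-first-letter true  v∉E = begin
        sumBy (λ w → 𝟙 (fresh (v ∷ E) w ∧ h (lastOr v w))) (wordsOver A (suc m))
          ≡⟨ count-fresh-words m (v ∷ E) h v ⟩
        falling (free (v ∷ E) ∸ 1) m * freeWith (v ∷ E) h
          ≡⟨ cong (λ r → falling (r ∸ 1) m * freeWith (v ∷ E) h) (free-∷ E v∈A v∉E) ⟩
        c * freeWith (v ∷ E) h
          ≡⟨ cong (c *_) (+-identityʳ (freeWith (v ∷ E) h)) ⟨
        c * (1 * freeWith (v ∷ E) h) ∎

  pairCount : (ℕ → ℕ → Bool) → ℕ
  pairCount q = sumBy (λ a → freeWith (a ∷ []) (q a)) A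

  count-by-endpoints : ∀ m q →
    sumBy (λ π → 𝟙 (distinct π ∧ endsWith q π)) (wordsOver A (suc (suc m))) ≡ falling (length A ∸ 2) m * pairCount q
  count-by-endpoints m q = begin
    sumBy (λ π → 𝟙 (distinct π ∧ endsWith q π)) (wordsOver A (suc (suc m)))
      ≡⟨ sumBy-concatMap _ (λ a → map (a ∷_) (wordsOver A (suc m))) A ⟩
    sumBy (λ a → sumBy (λ π → 𝟙 (distinct π ∧ endsWith q π)) (map (a ∷_) (wordsOver A (suc m)))) A
      ≡⟨ sumBy-cong-∈ A starting-with ⟩
    sumBy (λ a → falling (length A ∸ 2) m * freeWith (a ∷ []) (q a)) A
      ≡⟨ sumBy-*ˡ (falling (length A ∸ 2) m) _ A ⟩
    falling (length A ∸ 2) m * pairCount q ∎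
    where
    open ≡-Reasoning
    starting-with : ∀ {a} → a ∈ A →
      sumBy (λ π → 𝟙 (distinct π ∧ endsWith q π)) (map (a ∷_) (wordsOver A (suc m)))
        ≡ falling (length A ∸ 2) m * freeWith (a ∷ []) (q a)
    starting-with {a} a∈A = begin
      sumBy (λ π → 𝟙 (distinct π ∧ endsWith q π)) (map (a ∷_) (wordsOver A (suc m)))
        ≡⟨ sumBy-map _ (a ∷_) (wordsOver A (suc m)) ⟩
      sumBy (λ w → 𝟙 (distinct (a ∷ w) ∧ q a (lastOr a w))) (wordsOver A (suc m))
        ≡⟨ sumBy-cong (wordsOver A (suc m)) (λ w → cong (λ b → 𝟙 (b ∧ q a (lastOr a w))) (distinct-∷ a w)) ⟩
      sumBy (λ w → 𝟙 (fresh (a ∷ []) w ∧ q a (lastOr a w))) (wordsOver A (suc m))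
        ≡⟨ count-fresh-words m (a ∷ []) (q a) a ⟩
      falling (free (a ∷ []) ∸ 1) m * freeWith (a ∷ []) (q a)
        ≡⟨ cong (λ r → falling r m * freeWith (a ∷ []) (q a)) free-singleton ⟩
      falling (length A ∸ 2) m * freeWith (a ∷ []) (q a) ∎
      where
      free-singleton : free (a ∷ []) ∸ 1 ≡ length A ∸ 2
      free-singleton = begin
        free (a ∷ []) ∸ 1  ≡⟨ cong (_∸ 1) (free-∷ [] a∈A refl) ⟩
        free [] ∸ 1 ∸ 1    ≡⟨ cong (λ r → r ∸ 1 ∸ 1) free-[] ⟩
        length A ∸ 1 ∸ 1   ≡⟨ ∸-+-assoc (length A) 1 1 ⟩
        length A ∸ 2       ∎

  pairCount-cong : ∀ {q q′} → (∀ a b → q a b ≡ q′ a b) → pairCount q ≡ pairCount q′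
  pairCount-cong q≗q′ =
    sumBy-cong A (λ a → sumBy-cong A (λ b → cong (λ x → 𝟙 (notIn (a ∷ []) b ∧ x)) (q≗q′ a b)))

  pairCount-all : pairCount (λ _ _ → true) ≡ length A * (length A ∸ 1)
  pairCount-all = begin
    sumBy (λ a → free (a ∷ [])) A  ≡⟨ sumBy-cong-∈ A (λ a∈A → free-∷ [] a∈A refl) ⟩
    sumBy (λ _ → free [] ∸ 1) A    ≡⟨ sumBy-const (free [] ∸ 1) A ⟩
    length A * (free [] ∸ 1)       ≡⟨ cong (λ r → length A * (r ∸ 1)) free-[] ⟩
    length A * (length A ∸ 1)      ∎
    where open ≡-Reasoning

  pairCount-not : ∀ q → pairCount (λ a b → not (q a b)) + pairCount q ≡ length A * (length A ∸ 1)
  pairCount-not q = begin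
    pairCount (λ a b → not (q a b)) + pairCount q
      ≡⟨ sumBy-+ _ _ A ⟨
    sumBy (λ a → freeWith (a ∷ []) (λ b → not (q a b)) + freeWith (a ∷ []) (q a)) A
      ≡⟨ sumBy-cong A (λ a → sym (sumBy-+ _ _ A)) ⟩
    sumBy (λ a → sumBy (λ b → 𝟙 (notIn (a ∷ []) b ∧ not (q a b)) + 𝟙 (notIn (a ∷ []) b ∧ q a b)) A) A
      ≡⟨ sumBy-cong A (λ a → sumBy-cong A (λ b → excluded-middle (notIn (a ∷ []) b) (q a b))) ⟩
    pairCount (λ _ _ → true)
      ≡⟨ pairCount-all ⟩
    length A * (length A ∸ 1) ∎
    where
    open ≡-Reasoning
    excluded-middle : ∀ x y → 𝟙 (x ∧ not y) + 𝟙 (x ∧ y) ≡ 𝟙 (x ∧ true)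
    excluded-middle false y     = refl
    excluded-middle true  false = refl
    excluded-middle true  true  = refl

  -- Coefficient sequence of Σ_{(a,b)} x^{[q a b]}, a polynomial of degree at most one.
  pairCount-indicator : ∀ q j →
    pairCount (λ a b → 𝟙 (q a b) ≡ᵇ j) ≡ linPoly (pairCount q) (length A * (length A ∸ 1) ∸ pairCount q) j
  pairCount-indicator q zero = begin
    pairCount (λ a b → 𝟙 (q a b) ≡ᵇ 0)                  ≡⟨ pairCount-cong (λ a b → 𝟙≡ᵇ0 (q a b)) ⟩
    pairCount (λ a b → not (q a b))                      ≡⟨ m+n∸n≡m _ (pairCount q) ⟨
    pairCount (λ a b → not (q a b)) + pairCount q ∸ pairCount q ≡⟨ cong (_∸ pairCount q) (pairCount-not q) ⟩
    length A * (length A ∸ 1) ∸ pairCount q              ∎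
    where
    open ≡-Reasoning
    𝟙≡ᵇ0 : ∀ x → (𝟙 x ≡ᵇ 0) ≡ not x
    𝟙≡ᵇ0 false = refl
    𝟙≡ᵇ0 true  = refl
  pairCount-indicator q (suc zero) = pairCount-cong (λ a b → 𝟙≡ᵇ1 (q a b))
    where
    𝟙≡ᵇ1 : ∀ x → (𝟙 x ≡ᵇ 1) ≡ x
    𝟙≡ᵇ1 false = refl
    𝟙≡ᵇ1 true  = refl
  pairCount-indicator q (suc (suc j)) = sumBy-zero A (λ a → sumBy-zero A (λ b → never (notIn (a ∷ []) b) (q a b)))
    where
    never : ∀ x y → 𝟙 (x ∧ (𝟙 y ≡ᵇ suc (suc j))) ≡ 0
    never false y     = refl
    never true  false = refl
    never true  true  = refl

upFrom : ℕ → ℕ → List ℕ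
upFrom s zero    = []
upFrom s (suc k) = s ∷ upFrom (suc s) k

applyUpTo≡upFrom : ∀ (f : ℕ → ℕ) s k → (∀ i → f i ≡ s + i) → applyUpTo f k ≡ upFrom s k
applyUpTo≡upFrom f s zero    f≗s+ = refl
applyUpTo≡upFrom f s (suc k) f≗s+ = cong₂ _∷_ (trans (f≗s+ 0) (+-identityʳ s))
  (applyUpTo≡upFrom (λ i → f (suc i)) (suc s) k (λ i → trans (f≗s+ (suc i)) (+-suc s i)))

alphabet≡upFrom : ∀ n → map suc (upTo n) ≡ upFrom 1 n
alphabet≡upFrom n = trans (map-upTo suc n) (applyUpTo≡upFrom suc 1 n (λ i → refl))

length-alphabet : ∀ n → length (map suc (upTo n)) ≡ n
length-alphabet n = trans (length-map suc (upTo n)) (length-upTo n)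

noneEq-upFrom : ∀ {s t} k → s < t → noneEq s (upFrom t k) ≡ true
noneEq-upFrom zero    s<t = refl
noneEq-upFrom (suc k) s<t rewrite <⇒≡ᵇ≡false s<t = noneEq-upFrom k (m≤n⇒m≤1+n s<t)

distinct-upFrom : ∀ s k → distinct (upFrom s k) ≡ true
distinct-upFrom s zero    = refl
distinct-upFrom s (suc k) rewrite noneEq-upFrom {s} k ≤-refl = distinct-upFrom (suc s) k

distinct-alphabet : ∀ n → distinct (map suc (upTo n)) ≡ true
distinct-alphabet n = subst (λ xs → distinct xs ≡ true) (sym (alphabet≡upFrom n)) (distinct-upFrom 1 n)

∈-upFrom⇒< : ∀ {a s} k → a ∈ upFrom s k → a < s + k
∈-upFrom⇒< {s = s} (suc k) (here refl) = m<m+n s z<s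
∈-upFrom⇒< {a} {s} (suc k) (there a∈) = subst (a <_) (sym (+-suc s k)) (∈-upFrom⇒< k a∈)

upFrom-∷ʳ : ∀ s k → upFrom s (suc k) ≡ upFrom s k ++ (s + k ∷ [])
upFrom-∷ʳ s zero    = cong (_∷ []) (sym (+-identityʳ s))
upFrom-∷ʳ s (suc k) = cong (s ∷_) (trans (upFrom-∷ʳ (suc s) k) (cong (λ x → upFrom (suc s) k ++ (x ∷ [])) (sym (+-suc s k))))

count-below : ∀ k s a → a ≤ s + k → sumBy (λ b → 𝟙 (b <ᵇ a)) (upFrom s k) ≡ a ∸ s
count-below zero    s a a≤s+0 = sym (m≤n⇒m∸n≡0 (subst (a ≤_) (+-identityʳ s) a≤s+0))
count-below (suc k) s a a≤s+k with s <? a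
... | yes s<a rewrite <⇒<ᵇ≡true s<a =
  trans (cong suc (count-below k (suc s) a (subst (a ≤_) (+-suc s k) a≤s+k))) (sym (+-∸-assoc 1 s<a))
... | no s≮a rewrite ≤⇒<ᵇ≡false (≮⇒≥ s≮a) = begin
  sumBy (λ b → 𝟙 (b <ᵇ a)) (upFrom (suc s) k) ≡⟨ count-below k (suc s) a (m≤n⇒m≤1+n (≤-trans a≤s (m≤m+n s k))) ⟩
  a ∸ suc s                                  ≡⟨ m≤n⇒m∸n≡0 (m≤n⇒m≤1+n a≤s) ⟩
  0                                          ≡⟨ m≤n⇒m∸n≡0 a≤s ⟨
  a ∸ s                                      ∎
  where
  open ≡-Reasoning
  a≤s : a ≤ s
  a≤s = ≮⇒≥ s≮a

even : ℕ → Bool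
even zero          = true
even (suc zero)    = false
even (suc (suc n)) = even n

half : ℕ → ℕ
half zero          = 0
half (suc zero)    = 0
half (suc (suc n)) = suc (half n)

even-suc : ∀ n → even (suc n) ≡ not (even n)
even-suc zero          = refl
even-suc (suc zero)    = refl
even-suc (suc (suc n)) = even-suc n

2∣?≡even : ∀ n → does (2 ∣? n) ≡ even n
2∣?≡even zero          = refl
2∣?≡even (suc zero)    = refl
2∣?≡even (suc (suc n)) = 2∣?≡even n

n/2≡half : ∀ n → n / 2 ≡ half n
n/2≡half zero          = refl
n/2≡half (suc zero)    = refl
n/2≡half (suc (suc n)) = trans (m/n≡1+[m∸n]/n {suc (suc n)} {2} (s≤s (s≤s z≤n))) (cong suc (n/2≡half n))

half+half : ∀ n → n ≡ half n + half n + 𝟙 (not (even n))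
half+half zero          = refl
half+half (suc zero)    = refl
half+half (suc (suc n)) = trans (cong (λ m → suc (suc m)) (half+half n)) (+-suc-suc (half n) (𝟙 (not (even n))))
  where
  +-suc-suc : ∀ h e → suc (suc (h + h + e)) ≡ suc h + suc h + e
  +-suc-suc = solve-∀

sum-even-pred : ∀ n → sumBy (λ a → 𝟙 (even a) * (a ∸ 1)) (upFrom 1 n) ≡ half n * half n
sum-even-pred zero          = refl
sum-even-pred (suc zero)    = refl
sum-even-pred (suc (suc n)) = begin
  Σ (suc (suc n))                                          ≡⟨ Σ-suc (suc n) ⟩
  Σ (suc n) + 𝟙 (even n) * suc n                           ≡⟨ cong (_+ 𝟙 (even n) * suc n) (Σ-suc n) ⟩
  Σ n + 𝟙 (even (suc n)) * n + 𝟙 (even n) * suc n           ≡⟨ cong (λ e → Σ n + 𝟙 e * n + 𝟙 (even n) * suc n) (even-suc n) ⟩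
  Σ n + 𝟙 (not (even n)) * n + 𝟙 (even n) * suc n           ≡⟨ cong (λ s → s + 𝟙 (not (even n)) * n + 𝟙 (even n) * suc n) (sum-even-pred n) ⟩
  half n * half n + 𝟙 (not (even n)) * n + 𝟙 (even n) * suc n ≡⟨ next-square (even n) (half n) n (half+half n) ⟩
  suc (half n) * suc (half n)                               ∎
  where
  open ≡-Reasoning
  Σ : ℕ → ℕ
  Σ m = sumBy (λ a → 𝟙 (even a) * (a ∸ 1)) (upFrom 1 m)
  Σ-suc : ∀ m → Σ (suc m) ≡ Σ m + 𝟙 (even (suc m)) * m
  Σ-suc m = trans (cong (sumBy (λ a → 𝟙 (even a) * (a ∸ 1))) (upFrom-∷ʳ 1 m))
                  (trans (sumBy-++ _ (upFrom 1 m) (suc m ∷ [])) (cong (Σ m +_) (+-identityʳ _)))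
  next-square : ∀ e h m → m ≡ h + h + 𝟙 (not e) → h * h + 𝟙 (not e) * m + 𝟙 e * suc m ≡ suc h * suc h
  next-square true  h m refl = square-even h
    where
    square-even : ∀ h → h * h + 0 * (h + h + 0) + 1 * suc (h + h + 0) ≡ suc h * suc h
    square-even = solve-∀
  next-square false h m refl = square-odd h
    where
    square-odd : ∀ h → h * h + 1 * (h + h + 1) + 0 * suc (h + h + 1) ≡ suc h * suc h
    square-odd = solve-∀

modInversion : ℕ → ℕ → ℕ → Bool
modInversion d a b = (b <ᵇ a) ∧ does (d ∣? a)

drop-lastOr : ∀ k d w → length w ≡ suc k → drop k w ≡ lastOr d w ∷ []
drop-lastOr zero    d (x ∷ []) _   = refl
drop-lastOr (suc k) d (x ∷ w)  ∣w∣ = drop-lastOr k x w (suc-injective ∣w∣)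

-- In a word of length k + 2 the only pair of positions k + 1 apart is (first, last).
modinv-first-last : ∀ d k a w → length w ≡ suc k → modinv d (suc k) (a ∷ w) ≡ 𝟙 (modInversion d a (lastOr a w))
modinv-first-last d k a w@(_ ∷ _) ∣w∣ rewrite drop-lastOr k a w ∣w∣ with modInversion d a (lastOr a w)
... | true  = refl
... | false = refl

module Alphabet (n : ℕ) = InjectiveWords (map suc (upTo n)) (distinct-alphabet n)

Lcoeff-by-endpoints : ∀ d k j →
  Lcoeff (suc (suc k)) d (suc k) j ≡ k ! * Alphabet.pairCount (suc (suc k)) (λ a b → 𝟙 (modInversion d a b) ≡ᵇ j)
Lcoeff-by-endpoints d k j = begin
  Lcoeff n d (suc k) j
    ≡⟨ length-filterᵇ-filterᵇ distinct (λ π → modinv d (suc k) π ≡ᵇ j) (words n n) ⟩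
  sumBy (λ π → 𝟙 (distinct π ∧ (modinv d (suc k) π ≡ᵇ j))) (words n n)
    ≡⟨ cong (sumBy _) (words≡wordsOver n n) ⟩
  sumBy (λ π → 𝟙 (distinct π ∧ (modinv d (suc k) π ≡ᵇ j))) (wordsOver A n)
    ≡⟨ sumBy-wordsOver-cong A n by-endpoints ⟩
  sumBy (λ π → 𝟙 (distinct π ∧ endsWith q π)) (wordsOver A n)
    ≡⟨ count-by-endpoints k q ⟩
  falling (length A ∸ 2) k * pairCount q
    ≡⟨ cong (λ m → falling (m ∸ 2) k * pairCount q) (length-alphabet n) ⟩
  falling k k * pairCount q
    ≡⟨ cong (_* pairCount q) (falling-! k) ⟩
  k ! * pairCount q ∎
  where
  open ≡-Reasoning
  n : ℕ
  n = suc (suc k)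
  A : List ℕ
  A = map suc (upTo n)
  open Alphabet n
  q : ℕ → ℕ → Bool
  q a b = 𝟙 (modInversion d a b) ≡ᵇ j
  by-endpoints : ∀ π → length π ≡ n →
    𝟙 (distinct π ∧ (modinv d (suc k) π ≡ᵇ j)) ≡ 𝟙 (distinct π ∧ endsWith q π)
  by-endpoints (a ∷ w) ∣π∣ =
    cong (λ i → 𝟙 (distinct (a ∷ w) ∧ (i ≡ᵇ j))) (modinv-first-last d k a w (suc-injective ∣π∣))

pairCount-evenTop : ∀ n → Alphabet.pairCount n (modInversion 2) ≡ half n * half n
pairCount-evenTop n = begin
  pairCount (modInversion 2)
    ≡⟨ sumBy-cong A (λ a → sumBy-cong A (λ b → pointwise a b)) ⟩
  sumBy (λ a → sumBy (λ b → 𝟙 (even a) * 𝟙 (b <ᵇ a)) A) A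
    ≡⟨ cong (λ xs → sumBy (λ a → sumBy (λ b → 𝟙 (even a) * 𝟙 (b <ᵇ a)) xs) xs) (alphabet≡upFrom n) ⟩
  sumBy (λ a → sumBy (λ b → 𝟙 (even a) * 𝟙 (b <ᵇ a)) (upFrom 1 n)) (upFrom 1 n)
    ≡⟨ sumBy-cong-∈ (upFrom 1 n) below ⟩
  sumBy (λ a → 𝟙 (even a) * (a ∸ 1)) (upFrom 1 n)
    ≡⟨ sum-even-pred n ⟩
  half n * half n ∎
  where
  open ≡-Reasoning
  A : List ℕ
  A = map suc (upTo n)
  open Alphabet n
  pointwise : ∀ a b → 𝟙 (notIn (a ∷ []) b ∧ modInversion 2 a b) ≡ 𝟙 (even a) * 𝟙 (b <ᵇ a)
  pointwise a b with b <ᵇ a in b<ᵇa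
  ... | false = trans (cong 𝟙 (∧-zeroʳ (notIn (a ∷ []) b))) (sym (*-zeroʳ (𝟙 (even a))))
  ... | true rewrite <⇒≡ᵇ≡false (<ᵇ⇒< b a (subst T (sym b<ᵇa) tt)) | 2∣?≡even a = sym (*-identityʳ (𝟙 (even a)))
  below : ∀ {a} → a ∈ upFrom 1 n → sumBy (λ b → 𝟙 (even a) * 𝟙 (b <ᵇ a)) (upFrom 1 n) ≡ 𝟙 (even a) * (a ∸ 1)
  below {a} a∈ = trans (sumBy-*ˡ (𝟙 (even a)) _ (upFrom 1 n))
                       (cong (𝟙 (even a) *_) (count-below n 1 a (<⇒≤ (∈-upFrom⇒< n a∈))))

Lcoeff-evenTop-lastStep : ∀ k j → let n = suc (suc k); H = half n * half n in
  Lcoeff n 2 (suc k) j ≡ k ! * linPoly H (n * suc k ∸ H) j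
Lcoeff-evenTop-lastStep k j = begin
  Lcoeff n 2 (suc k) j
    ≡⟨ Lcoeff-by-endpoints 2 k j ⟩
  k ! * pairCount (λ a b → 𝟙 (modInversion 2 a b) ≡ᵇ j)
    ≡⟨ cong (k ! *_) (pairCount-indicator (modInversion 2) j) ⟩
  k ! * linPoly (pairCount (modInversion 2)) (length A * (length A ∸ 1) ∸ pairCount (modInversion 2)) j
    ≡⟨ cong₂ (λ h m → k ! * linPoly h (m * (m ∸ 1) ∸ h) j) (pairCount-evenTop n) (length-alphabet n) ⟩
  k ! * linPoly (half n * half n) (n * suc k ∸ half n * half n) j ∎
  where
  open ≡-Reasoning
  n : ℕ
  n = suc (suc k)
  A : List ℕ
  A = map suc (upTo n)
  open Alphabet n

proposition5p1 : (n : ℕ) → 2 ≤ n →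
    LeadingCoeff (Lcoeff n 2 (n ∸ 1)) ((n / 2) * (n / 2) * (n ∸ 2) !)
    × (∀ j → Lcoeff n 2 (n ∸ 1) j
             ≡ (n ∸ 2) ! * linPoly ((n / 2) * (n / 2)) (n * (n ∸ 1) ∸ (n / 2) * (n / 2)) j)
proposition5p1 n@(suc (suc k)) (s≤s (s≤s z≤n)) rewrite n/2≡half n =
  (1 , leading , leading≢0 , vanishing) , Lcoeff-evenTop-lastStep k
  where
  leading : Lcoeff n 2 (suc k) 1 ≡ half n * half n * k !
  leading = trans (Lcoeff-evenTop-lastStep k 1) (*-comm (k !) _)
  leading≢0 : half n * half n * k ! ≢ 0
  leading≢0 = ≢-nonZero⁻¹ _ {{m*n≢0 (half n * half n) (k !) {{_}} {{k !≢0}}}}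
  vanishing : ∀ j → 1 < j → Lcoeff n 2 (suc k) j ≡ 0
  vanishing (suc zero)    (s≤s ())
  vanishing (suc (suc j)) _ = trans (Lcoeff-evenTop-lastStep k (suc (suc j))) (*-zeroʳ (k !))
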